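{- The sign pattern $\begin{bmatrix}0&+&0\\-&0&+\\+&-&0\end{bmatrix}$ requires algebraic positivity.
   Context: For a sign pattern $S$ (matrix with entries in $\{+,-,0\}$), $Q(S)$ is the set of real matrices $X$ with $\mathrm{sgn}(X_{ij})=S_{ij}$ for all $i,j$. A real square matrix $M$ is algebraically positive if there is a real polynomial $p$ with all entries of $p(M)$ positive. $S$ requires algebraic positivity if every $X\in Q(S)$ is algebraically positive. -}

module Defs where

open import Level using (Level; _⊔_) renaming (suc to lsuc)
open import Algebra.Bundles using (CommutativeRing)
open import Relation.Binary.Structures using (IsStrictTotalOrder)
open import Relation.Nullary using (¬_)
open import Data.Product using (∃; Σ; _×_)
open import Data.Fin using (Fin; zero; suc)
open import Data.Nat using (ℕ)
open import Data.List using (List; []; _∷_)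
open import Data.Bool using (Bool; true; false)

-- An ordered field: a commutative ring with a strict total order compatible
-- with + and *, in which every nonzero element is invertible.
-- (The real numbers ℝ are an instance; agda-stdlib has no reals.)
record OrderedField (c ℓ ℓ' : Level) : Set (lsuc (c ⊔ ℓ ⊔ ℓ')) where
  field
    commRing : CommutativeRing c ℓ
  open CommutativeRing commRing public
  field
    _<_                : Carrier → Carrier → Set ℓ'
    isStrictTotalOrder : IsStrictTotalOrder _≈_ _<_
    +-mono-<           : ∀ {x y} z → x < y → (x + z) < (y + z)
    *-pos              : ∀ {x y} → 0# < x → 0# < y → 0# < (x * y)
    inverse            : ∀ x → ¬ (x ≈ 0#) → ∃ λ y → (x * y) ≈ 1#

data Sign : Set where
  ⊕ ⊖ ⊙ : Sign

SignPattern : ℕ → Set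
SignPattern n = Fin n → Fin n → Sign

module _ {c ℓ ℓ'} (F : OrderedField c ℓ ℓ') where
  open OrderedField F using (Carrier; _≈_; _<_; _+_; _*_; 0#; 1#)

  Matrix : ℕ → Set c
  Matrix n = Fin n → Fin n → Carrier

  HasSign : Carrier → Sign → Set (ℓ ⊔ ℓ')
  HasSign x ⊕ = Level.Lift (ℓ ⊔ ℓ') (0# < x)
  HasSign x ⊖ = Level.Lift (ℓ ⊔ ℓ') (x < 0#)
  HasSign x ⊙ = Level.Lift (ℓ ⊔ ℓ') (x ≈ 0#)

  InQ : ∀ {n} → SignPattern n → Matrix n → Set (ℓ ⊔ ℓ')
  InQ {n} S X = ∀ (i j : Fin n) → HasSign (X i j) (S i j)

  sumFin : ∀ n → (Fin n → Carrier) → Carrier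
  sumFin ℕ.zero    f = 0#
  sumFin (ℕ.suc n) f = f zero + sumFin n (λ k → f (suc k))

  _·_ : ∀ {n} → Matrix n → Matrix n → Matrix n
  _·_ {n} A B i j = sumFin n (λ k → A i k * B k j)

  identity : ∀ {n} → Matrix n
  identity zero    zero    = 1#
  identity zero    (suc j) = 0#
  identity (suc i) zero    = 0#
  identity (suc i) (suc j) = identity i j

  scale : ∀ {n} → Carrier → Matrix n → Matrix n
  scale a A i j = a * A i j

  addM : ∀ {n} → Matrix n → Matrix n → Matrix n
  addM A B i j = A i j + B i j

  -- A real polynomial is its coefficient list [c₀, c₁, …, c_d];
  -- evalPoly (c₀ ∷ cs) X = c₀ I + X · evalPoly cs X   (Horner scheme)
  evalPoly : ∀ {n} → List Carrier → Matrix n → Matrix n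
  evalPoly []       X i j = 0#
  evalPoly (a ∷ cs) X     = addM (scale a identity) (X · evalPoly cs X)

  AlgebraicallyPositive : ∀ {n} → Matrix n → Set (c ⊔ ℓ')
  AlgebraicallyPositive {n} M =
    Σ (List Carrier) λ p → ∀ (i j : Fin n) → 0# < evalPoly p M i j

  RequiresAP : ∀ {n} → SignPattern n → Set (c ⊔ ℓ ⊔ ℓ')
  RequiresAP {n} S = ∀ (X : Matrix n) → InQ S X → AlgebraicallyPositive X

S₈ : SignPattern 3
S₈ zero zero = ⊙
S₈ zero (suc zero) = ⊕
S₈ zero (suc (suc zero)) = ⊙
S₈ (suc zero) zero = ⊖
S₈ (suc zero) (suc zero) = ⊙
S₈ (suc zero) (suc (suc zero)) = ⊕
S₈ (suc (suc zero)) zero = ⊕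
S₈ (suc (suc zero)) (suc zero) = ⊖
S₈ (suc (suc zero)) (suc (suc zero)) = ⊙

module Submission where

-- Write a matrix of the sign pattern S₈ as
--
--        ⎡ 0   a   0 ⎤
--    M = ⎢ b   0   c ⎥     with  a, c, d > 0  and  b = -B, e = -E  for  B, E > 0.
--        ⎣ d   e   0 ⎦
--
-- With  γ = aB + cE,  β = acd  and  α = γ + γ²  the quadratic polynomial
-- p(x) = α + βx + γx² makes every entry of p(M) = αI + βM + γM² a sum of
-- products of the positive quantities a, c, d, B, E, γ, β and eb, so M is
-- algebraically positive.
--
-- The
-- entrywise identities for the pattern matrix are polynomial identities in
-- a, b, c, d, e, B, E modulo b + B = 0 and e + E = 0; they are stated once,
-- over an arbitrary raw semiring, and checked by the commutative semiring
-- solver.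

open import Level using (Level; lower)
open import Algebra.Bundles using (Semiring)
open import Algebra.Bundles.Raw using (RawSemiring)
open import Data.Fin using (Fin; zero; suc)
open import Data.List using (List; []; _∷_)
open import Data.Nat using (ℕ)
open import Data.Product using (_,_; _×_)
open import Relation.Binary.Structures using (IsStrictTotalOrder)
open import Relation.Binary.PropositionalEquality using (_≡_)
import Algebra.Properties.CommutativeSemigroup as CommutativeSemigroupProperties
import Algebra.Properties.Ring as RingProperties
import Algebra.Solver.Ring.NaturalCoefficients.Default as NaturalCoefficientSolver
import Relation.Binary.Reasoning.Setoid as SetoidReasoning

open import Defs

module OrderedFieldProperties {c ℓ ℓ'} (F : OrderedField c ℓ ℓ') where
  open OrderedField F hiding (zero)
  open IsStrictTotalOrder isStrictTotalOrder using (<-respʳ-≈; <-respˡ-≈) renaming (trans to <-trans)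
  open RingProperties ring using (-‿distribˡ-*; -‿distribʳ-*; -‿involutive)
  open SetoidReasoning setoid

  -- 0 < y < x + y, since adding y preserves 0 < x.
  +-pos : ∀ {x y} → 0# < x → 0# < y → 0# < (x + y)
  +-pos {x} {y} 0<x 0<y = <-trans 0<y (<-respˡ-≈ (+-identityˡ y) (+-mono-< y 0<x))

  -- Adding -x to x < 0 gives 0 < -x.
  neg⇒-pos : ∀ {x} → x < 0# → 0# < (- x)
  neg⇒-pos {x} x<0 =
    <-respˡ-≈ (-‿inverseʳ x) (<-respʳ-≈ (+-identityˡ (- x)) (+-mono-< (- x) x<0))

  -- xy = (-x)(-y), a product of positives.
  *-neg : ∀ {x y} → x < 0# → y < 0# → 0# < (x * y)
  *-neg {x} {y} x<0 y<0 = <-respʳ-≈ -x*-y≈x*y (*-pos (neg⇒-pos x<0) (neg⇒-pos y<0))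
    where
    -x*-y≈x*y : - x * - y ≈ x * y
    -x*-y≈x*y = begin
      - x * - y      ≈⟨ -‿distribˡ-* x (- y) ⟨
      - (x * - y)    ≈⟨ -‿cong (-‿distribʳ-* x y) ⟨
      - (- (x * y))  ≈⟨ -‿involutive (x * y) ⟩
      x * y          ∎

module MatrixAlgebra {c ℓ ℓ'} (F : OrderedField c ℓ ℓ') where
  open OrderedField F hiding (zero)
  open CommutativeSemigroupProperties +-commutativeSemigroup using () renaming (interchange to +-interchange)
  open CommutativeSemigroupProperties *-commutativeSemigroup using () renaming (x∙yz≈y∙xz to *-x∙yz≈y∙xz)
  open SetoidReasoning setoid

  infixl 7 _∙_
  _∙_ : ∀ {n} → Matrix F n → Matrix F n → Matrix F n
  _∙_ = _·_ F

  I 𝟎 : ∀ {n} → Matrix F n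
  I = identity F
  𝟎 _ _ = 0#

  infix 4 _≋_
  _≋_ : ∀ {n} → Matrix F n → Matrix F n → Set ℓ
  A ≋ B = ∀ i j → A i j ≈ B i j

  sumFin-cong : ∀ n {f g : Fin n → Carrier} → (∀ k → f k ≈ g k) → sumFin F n f ≈ sumFin F n g
  sumFin-cong ℕ.zero    f≈g = refl
  sumFin-cong (ℕ.suc n) f≈g = +-cong (f≈g zero) (sumFin-cong n (λ k → f≈g (suc k)))

  sumFin-+ : ∀ n (f g : Fin n → Carrier) →
             sumFin F n (λ k → f k + g k) ≈ sumFin F n f + sumFin F n g
  sumFin-+ ℕ.zero    f g = sym (+-identityʳ 0#)
  sumFin-+ (ℕ.suc n) f g = begin
    (f zero + g zero) + sumFin F n (λ k → f (suc k) + g (suc k))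
      ≈⟨ +-congˡ (sumFin-+ n (λ k → f (suc k)) (λ k → g (suc k))) ⟩
    (f zero + g zero) + (sumFin F n (λ k → f (suc k)) + sumFin F n (λ k → g (suc k)))
      ≈⟨ +-interchange (f zero) (g zero) _ _ ⟩
    (f zero + sumFin F n (λ k → f (suc k))) + (g zero + sumFin F n (λ k → g (suc k)))  ∎

  sumFin-*ˡ : ∀ n r (f : Fin n → Carrier) → sumFin F n (λ k → r * f k) ≈ r * sumFin F n f
  sumFin-*ˡ ℕ.zero    r f = sym (zeroʳ r)
  sumFin-*ˡ (ℕ.suc n) r f = begin
    r * f zero + sumFin F n (λ k → r * f (suc k))  ≈⟨ +-congˡ (sumFin-*ˡ n r (λ k → f (suc k))) ⟩
    r * f zero + r * sumFin F n (λ k → f (suc k))  ≈⟨ distribˡ r (f zero) _ ⟨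
    r * (f zero + sumFin F n (λ k → f (suc k)))    ∎

  sumFin-*0 : ∀ n (f : Fin n → Carrier) → sumFin F n (λ k → f k * 0#) ≈ 0#
  sumFin-*0 n f = begin
    sumFin F n (λ k → f k * 0#)  ≈⟨ sumFin-cong n (λ k → *-comm (f k) 0#) ⟩
    sumFin F n (λ k → 0# * f k)  ≈⟨ sumFin-*ˡ n 0# f ⟩
    0# * sumFin F n f            ≈⟨ zeroˡ _ ⟩
    0#                           ∎

  sumFin-identity : ∀ n (v : Fin n → Carrier) j → sumFin F n (λ k → v k * I k j) ≈ v j
  sumFin-identity (ℕ.suc n) v zero = begin
    v zero * 1# + sumFin F n (λ k → v (suc k) * 0#)  ≈⟨ +-cong (*-identityʳ (v zero)) (sumFin-*0 n (λ k → v (suc k))) ⟩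
    v zero + 0#                                       ≈⟨ +-identityʳ (v zero) ⟩
    v zero                                            ∎
  sumFin-identity (ℕ.suc n) v (suc j) = begin
    v zero * 0# + sumFin F n (λ k → v (suc k) * I k j)  ≈⟨ +-cong (zeroʳ (v zero)) (sumFin-identity n (λ k → v (suc k)) j) ⟩
    0# + v (suc j)                                      ≈⟨ +-identityˡ (v (suc j)) ⟩
    v (suc j)                                           ∎

  ∙-congʳ : ∀ {n} (X : Matrix F n) {A B : Matrix F n} → A ≋ B → X ∙ A ≋ X ∙ B
  ∙-congʳ {n} X A≋B i j = sumFin-cong n (λ k → *-congˡ (A≋B k j))

  ∙-zeroʳ : ∀ {n} (X : Matrix F n) i j → (X ∙ 𝟎) i j ≈ 0#
  ∙-zeroʳ {n} X i j = sumFin-*0 n (X i)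

  ∙-scaleʳ : ∀ {n} (X A : Matrix F n) s i j → (X ∙ (λ k l → s * A k l)) i j ≈ s * (X ∙ A) i j
  ∙-scaleʳ {n} X A s i j = begin
    sumFin F n (λ k → X i k * (s * A k j))  ≈⟨ sumFin-cong n (λ k → *-x∙yz≈y∙xz (X i k) s (A k j)) ⟩
    sumFin F n (λ k → s * (X i k * A k j))  ≈⟨ sumFin-*ˡ n s _ ⟩
    s * (X ∙ A) i j                         ∎

  ∙-horner : ∀ {n} (X A : Matrix F n) r i j →
             (X ∙ (λ k l → r * I k l + A k l)) i j ≈ r * X i j + (X ∙ A) i j
  ∙-horner {n} X A r i j = begin
    sumFin F n (λ k → X i k * (r * I k j + A k j))
      ≈⟨ sumFin-cong n (λ k → distribˡ (X i k) _ _) ⟩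
    sumFin F n (λ k → X i k * (r * I k j) + X i k * A k j)
      ≈⟨ sumFin-+ n _ _ ⟩
    (X ∙ (λ k l → r * I k l)) i j + (X ∙ A) i j
      ≈⟨ +-congʳ (∙-scaleʳ X I r i j) ⟩
    r * sumFin F n (λ k → X i k * I k j) + (X ∙ A) i j
      ≈⟨ +-congʳ (*-congˡ (sumFin-identity n (X i) j)) ⟩
    r * X i j + (X ∙ A) i j  ∎

  evalPoly-cong : ∀ {n} (p : List Carrier) {X Y : Matrix F n} → X ≋ Y → evalPoly F p X ≋ evalPoly F p Y
  evalPoly-cong []       X≋Y i j = refl
  evalPoly-cong {n} (r ∷ p) X≋Y i j =
    +-congˡ (sumFin-cong n (λ k → *-cong (X≋Y i k) (evalPoly-cong p X≋Y k j)))

  evalPoly-quadratic : ∀ {n} α β γ (X : Matrix F n) i j →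
    evalPoly F (α ∷ β ∷ γ ∷ []) X i j ≈ α * I i j + (β * X i j + γ * (X ∙ X) i j)
  evalPoly-quadratic {n} α β γ X i j = +-congˡ (begin
    (X ∙ evalPoly F (β ∷ γ ∷ []) X) i j        ≈⟨ ∙-congʳ X linear i j ⟩
    (X ∙ (λ k l → β * I k l + γ * X k l)) i j  ≈⟨ ∙-horner X (λ k l → γ * X k l) β i j ⟩
    β * X i j + (X ∙ (λ k l → γ * X k l)) i j  ≈⟨ +-congˡ (∙-scaleʳ X X γ i j) ⟩
    β * X i j + γ * (X ∙ X) i j                ∎)
    where
    linear : evalPoly F (β ∷ γ ∷ []) X ≋ (λ k l → β * I k l + γ * X k l)
    linear k l = +-congˡ (begin
      (X ∙ evalPoly F (γ ∷ []) X) k l  ≈⟨ ∙-horner X (X ∙ 𝟎) γ k l ⟩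
      γ * X k l + (X ∙ (X ∙ 𝟎)) k l    ≈⟨ +-congˡ (∙-congʳ X (∙-zeroʳ X) k l) ⟩
      γ * X k l + (X ∙ 𝟎) k l          ≈⟨ +-congˡ (∙-zeroʳ X k l) ⟩
      γ * X k l + 0#                   ≈⟨ +-identityʳ _ ⟩
      γ * X k l                        ∎)

-- The proof data for the pattern matrix, written over an arbitrary raw
-- semiring so that the same expressions can be read in the field and as
-- syntax for the semiring solver.  The parameters b and e stand for the
-- negative entries, B and E for their negatives.
module Certificate {r₁ r₂} (R : RawSemiring r₁ r₂) (a b c d e B E : RawSemiring.Carrier R) where
  open RawSemiring R using (Carrier; _+_; _*_; 0#; 1#)

  M : Fin 3 → Fin 3 → Carrier
  M zero             zero             = 0#
  M zero             (suc zero)       = a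
  M zero             (suc (suc zero)) = 0#
  M (suc zero)       zero             = b
  M (suc zero)       (suc zero)       = 0#
  M (suc zero)       (suc (suc zero)) = c
  M (suc (suc zero)) zero             = d
  M (suc (suc zero)) (suc zero)       = e
  M (suc (suc zero)) (suc (suc zero)) = 0#

  δ : Fin 3 → Fin 3 → Carrier
  δ zero             zero             = 1#
  δ (suc zero)       (suc zero)       = 1#
  δ (suc (suc zero)) (suc (suc zero)) = 1#
  δ _                _                = 0#

  -- (M²)ᵢⱼ = Σₖ Mᵢₖ Mₖⱼ, summed in the order used by sumFin.
  square : Fin 3 → Fin 3 → Carrier
  square i j = M i zero * M zero j + (M i (suc zero) * M (suc zero) j + (M i (suc (suc zero)) * M (suc (suc zero)) j + 0#))

  α β γ : Carrier
  γ = a * B + c * E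
  β = a * c * d
  α = γ + γ * γ

  quadratic : Fin 3 → Fin 3 → Carrier
  quadratic i j = α * δ i j + (β * M i j + γ * square i j)

  -- The entries of p(M), as sums of products of a, c, d, B, E, eb.
  certificate : Fin 3 → Fin 3 → Carrier
  certificate zero             zero             = γ + γ * (c * E)
  certificate zero             (suc zero)       = β * a
  certificate zero             (suc (suc zero)) = γ * (a * c)
  certificate (suc zero)       zero             = (c * d) * (c * E)
  certificate (suc zero)       (suc zero)       = γ
  certificate (suc zero)       (suc (suc zero)) = β * c
  certificate (suc (suc zero)) zero             = β * d + γ * (e * b)
  certificate (suc (suc zero)) (suc zero)       = (a * d) * (a * B)
  certificate (suc (suc zero)) (suc (suc zero)) = γ + γ * (a * B)

  -- Coefficients of b + B and e + E in  quadratic − certificate.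
  U V : Fin 3 → Fin 3 → Carrier
  U zero             zero             = γ * a
  U (suc zero)       zero             = β
  U (suc zero)       (suc zero)       = γ * a
  U _                _                = 0#
  V (suc zero)       (suc zero)       = γ * c
  V (suc (suc zero)) (suc zero)       = β
  V (suc (suc zero)) (suc (suc zero)) = γ * c
  V _                _                = 0#

  -- quadratic = certificate + correction holds as a polynomial identity.
  correction : Fin 3 → Fin 3 → Carrier
  correction i j = (b + B) * U i j + (e + E) * V i j

module EntryIdentities {o ℓ ℓ'} (F : OrderedField o ℓ ℓ') where
  open OrderedField F using (Carrier; _≈_; _+_; _*_; semiring; commutativeSemiring; refl)
  open MatrixAlgebra F using (I; _∙_)
  open Semiring semiring using (rawSemiring)
  module Solver = NaturalCoefficientSolver commutativeSemiring
  open Solver using (Polynomial; con; _:+_; _:*_; _:=_)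

  polynomials : RawSemiring _ _
  polynomials = record
    { Carrier = Polynomial 7 ; _≈_ = _≡_ ; _+_ = _:+_ ; _*_ = _:*_ ; 0# = con 0 ; 1# = con 1 }

  entryEquation : Fin 3 → Fin 3 → (a b c d e B E : Polynomial 7) → Polynomial 7 × Polynomial 7
  entryEquation i j a b c d e B E = quadratic i j := certificate i j :+ correction i j
    where open Certificate polynomials a b c d e B E

  quadratic≈certificate : ∀ i j (a b c d e B E : Carrier) → let open Certificate rawSemiring a b c d e B E in
                          α * I i j + (β * M i j + γ * (M ∙ M) i j) ≈ certificate i j + correction i j
  quadratic≈certificate zero             zero             = Solver.solve 7 (entryEquation zero zero) refl
  quadratic≈certificate zero             (suc zero)       = Solver.solve 7 (entryEquation zero (suc zero)) refl
  quadratic≈certificate zero             (suc (suc zero)) = Solver.solve 7 (entryEquation zero (suc (suc zero))) refl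
  quadratic≈certificate (suc zero)       zero             = Solver.solve 7 (entryEquation (suc zero) zero) refl
  quadratic≈certificate (suc zero)       (suc zero)       = Solver.solve 7 (entryEquation (suc zero) (suc zero)) refl
  quadratic≈certificate (suc zero)       (suc (suc zero)) = Solver.solve 7 (entryEquation (suc zero) (suc (suc zero))) refl
  quadratic≈certificate (suc (suc zero)) zero             = Solver.solve 7 (entryEquation (suc (suc zero)) zero) refl
  quadratic≈certificate (suc (suc zero)) (suc zero)       = Solver.solve 7 (entryEquation (suc (suc zero)) (suc zero)) refl
  quadratic≈certificate (suc (suc zero)) (suc (suc zero)) = Solver.solve 7 (entryEquation (suc (suc zero)) (suc (suc zero))) refl

module SignPatternS₈ {o ℓ ℓ'} (F : OrderedField o ℓ ℓ') {X : Matrix F 3} (X∈Q : InQ F S₈ X) where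
  open OrderedField F hiding (zero)
  open Semiring semiring using (rawSemiring)
  open OrderedFieldProperties F
  open MatrixAlgebra F using (_≋_)

  a b c d e B E : Carrier
  a = X zero (suc zero)
  b = X (suc zero) zero
  c = X (suc zero) (suc (suc zero))
  d = X (suc (suc zero)) zero
  e = X (suc (suc zero)) (suc zero)
  B = - b
  E = - e

  open Certificate rawSemiring a b c d e B E public

  X≋M : X ≋ M
  X≋M zero             zero             = lower (X∈Q zero zero)
  X≋M zero             (suc zero)       = refl
  X≋M zero             (suc (suc zero)) = lower (X∈Q zero (suc (suc zero)))
  X≋M (suc zero)       zero             = refl
  X≋M (suc zero)       (suc zero)       = lower (X∈Q (suc zero) (suc zero))
  X≋M (suc zero)       (suc (suc zero)) = refl
  X≋M (suc (suc zero)) zero             = refl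
  X≋M (suc (suc zero)) (suc zero)       = refl
  X≋M (suc (suc zero)) (suc (suc zero)) = lower (X∈Q (suc (suc zero)) (suc (suc zero)))

  correction-vanishes : ∀ x i j → x + correction i j ≈ x
  correction-vanishes x i j = begin
    x + ((b + B) * U i j + (e + E) * V i j)  ≈⟨ +-congˡ (+-cong (*-congʳ (-‿inverseʳ b)) (*-congʳ (-‿inverseʳ e))) ⟩
    x + (0# * U i j + 0# * V i j)            ≈⟨ +-congˡ (+-cong (zeroˡ (U i j)) (zeroˡ (V i j))) ⟩
    x + (0# + 0#)                            ≈⟨ +-congˡ (+-identityʳ 0#) ⟩
    x + 0#                                   ≈⟨ +-identityʳ x ⟩
    x                                        ∎
    where open SetoidReasoning setoid

  0<a : 0# < a
  0<a = lower (X∈Q zero (suc zero))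
  0<c : 0# < c
  0<c = lower (X∈Q (suc zero) (suc (suc zero)))
  0<d : 0# < d
  0<d = lower (X∈Q (suc (suc zero)) zero)
  b<0 : b < 0#
  b<0 = lower (X∈Q (suc zero) zero)
  e<0 : e < 0#
  e<0 = lower (X∈Q (suc (suc zero)) (suc zero))
  0<B : 0# < B
  0<B = neg⇒-pos b<0
  0<E : 0# < E
  0<E = neg⇒-pos e<0
  0<γ : 0# < γ
  0<γ = +-pos (*-pos 0<a 0<B) (*-pos 0<c 0<E)
  0<β : 0# < β
  0<β = *-pos (*-pos 0<a 0<c) 0<d

  certificate-positive : ∀ i j → 0# < certificate i j
  certificate-positive zero             zero             = +-pos 0<γ (*-pos 0<γ (*-pos 0<c 0<E))
  certificate-positive zero             (suc zero)       = *-pos 0<β 0<a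
  certificate-positive zero             (suc (suc zero)) = *-pos 0<γ (*-pos 0<a 0<c)
  certificate-positive (suc zero)       zero             = *-pos (*-pos 0<c 0<d) (*-pos 0<c 0<E)
  certificate-positive (suc zero)       (suc zero)       = 0<γ
  certificate-positive (suc zero)       (suc (suc zero)) = *-pos 0<β 0<c
  certificate-positive (suc (suc zero)) zero             = +-pos (*-pos 0<β 0<d) (*-pos 0<γ (*-neg e<0 b<0))
  certificate-positive (suc (suc zero)) (suc zero)       = *-pos (*-pos 0<a 0<d) (*-pos 0<a 0<B)
  certificate-positive (suc (suc zero)) (suc (suc zero)) = +-pos 0<γ (*-pos 0<γ (*-pos 0<a 0<B))

mainTheorem8 : ∀ {c ℓ ℓ' : Level} (F : OrderedField c ℓ ℓ') → RequiresAP F S₈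
mainTheorem8 F X X∈Q = p , λ i j → <-respʳ-≈ (sym (p[X]≈certificate i j)) (certificate-positive i j)
  where
  open OrderedField F hiding (zero)
  open IsStrictTotalOrder isStrictTotalOrder using (<-respʳ-≈)
  open MatrixAlgebra F using (I; _∙_; evalPoly-cong; evalPoly-quadratic)
  open EntryIdentities F using (quadratic≈certificate)
  open SignPatternS₈ F X∈Q
  open SetoidReasoning setoid

  p : List Carrier
  p = α ∷ β ∷ γ ∷ []

  p[X]≈certificate : ∀ i j → evalPoly F p X i j ≈ certificate i j
  p[X]≈certificate i j = begin
    evalPoly F p X i j                         ≈⟨ evalPoly-cong p X≋M i j ⟩
    evalPoly F p M i j                         ≈⟨ evalPoly-quadratic α β γ M i j ⟩
    α * I i j + (β * M i j + γ * (M ∙ M) i j)  ≈⟨ quadratic≈certificate i j a b c d e B E ⟩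
    certificate i j + correction i j           ≈⟨ correction-vanishes (certificate i j) i j ⟩
    certificate i j                            ∎
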